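{- Let $q$ be a prime power, $n\ge2$, $E=\mathbb{F}_q^n$, and $1\le k\le n-1$. Let $\mathcal{S}_1,\mathcal{S}_2$ be disjoint collections of $k$-dimensional subspaces of $E$ such that, for $i=1,2$, $\dim(V\cap W)\le k-2$ for all distinct $V,W\in\mathcal{S}_i$. Let $\mathcal{M}_i$ be the paving $q$-matroid induced by $\mathcal{S}_i$ with characteristic polynomial $\chi_{\mathcal{M}_i}$ ($i=1,2$), let $\lambda\in\mathbb{Q}$ with $0<\lambda<1$, and let $\mathcal{M}=\lambda\mathcal{M}_1+(1-\lambda)\mathcal{M}_2$. Then $$\chi_{\mathcal{M}}(t)=\chi_{\mathcal{M}_1}(t)+(-1)^kq^{\binom{k}{2}}\Big(|\mathcal{S}_1|(t^\lambda-t)+|\mathcal{S}_2|(t^{1-\lambda}-1)\Big)$$ and $$\chi_{\mathcal{M}}(t)=\chi_{\mathcal{M}_2}(t)+(-1)^kq^{\binom{k}{2}}\Big(|\mathcal{S}_1|(t^\lambda-1)+|\mathcal{S}_2|(t^{1-\lambda}-t)\Big).$$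
   Context: $\mathcal{L}(E)$ is the lattice of subspaces of $E$. The paving $q$-matroid induced by $\mathcal{S}$ has rank function $\rho_{\mathcal{S}}(V)=k-1$ if $V\in\mathcal{S}$ and $\min\{\dim V,k\}$ otherwise. $\lambda\mathcal{M}_1+(1-\lambda)\mathcal{M}_2$ has rank function $\lambda\rho_1+(1-\lambda)\rho_2$. For a $q$-polymatroid $(\mathcal{L}(E),\rho)$ with rational values, its characteristic (Puiseux) polynomial is $\chi(t)=\sum_{X\in\mathcal{L}(E)}(-1)^{\dim X}q^{\binom{\dim X}{2}}\,t^{\rho(E)-\rho(X)}$, a finite sum of monomials with possibly rational exponents; for a $q$-matroid this is its characteristic polynomial. -}

module Defs where

open import Data.Nat as ℕ using (ℕ; zero; suc; _≤ᵇ_; _⊓_)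
open import Data.Nat.Primality using (Prime)
import Data.Nat.Combinatorics
open import Data.Integer as ℤ using (ℤ)
open import Data.Rational as ℚ using (ℚ)
open import Data.Rational.Properties as ℚP using ()
open import Data.Fin using (Fin; combine; zero; suc)
open import Data.Fin.Subset using (Subset; ⊤; _∩_; ∣_∣)
open import Data.Vec as Vec using (Vec; []; _∷_; zipWith; lookup)
open import Data.Vec.Properties using (≡-dec)
open import Data.Bool as Bool using (Bool; true; false; if_then_else_; _∧_)
import Data.Bool.Properties as BoolP
open import Data.List as List using (List; []; _∷_; _++_; filter; map; concatMap; length; upTo; allFin)
open import Data.Bool.ListAction using (all; any)
open import Data.Product using (Σ; _×_; _,_; proj₁; proj₂)
open import Relation.Binary.PropositionalEquality using (_≡_; _≢_)
open import Relation.Nullary.Decidable using (⌊_⌋)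
open import Algebra.Structures using (IsCommutativeRing)

IsPrimePower : ℕ → Set
IsPrimePower q = Σ ℕ λ p → Σ ℕ λ m → Prime p × (1 ℕ.≤ m) × (q ≡ p ℕ.^ m)

-- A finite field with q elements.  Every finite field of order q is
-- isomorphic to one whose carrier is Fin q, so we take Fin q as carrier.

record FiniteField (q : ℕ) : Set where
  field
    _+_ _*_      : Fin q → Fin q → Fin q
    -_           : Fin q → Fin q
    0# 1#        : Fin q
    isCommRing   : IsCommutativeRing _≡_ _+_ _*_ -_ 0# 1#
    0≢1          : 0# ≢ 1#
    inverse      : (x : Fin q) → x ≢ 0# → Σ (Fin q) λ y → x * y ≡ 1#

-- Puiseux polynomials with integer coefficients: finite formal sums of
-- monomials c·t^e with e ∈ ℚ, represented as lists of (c , e); two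
-- such sums are equal iff they have the same coefficient at every
-- exponent.

Puiseux : Set
Puiseux = List (ℤ × ℚ)

coeff : Puiseux → ℚ → ℤ
coeff []             e = ℤ.0ℤ
coeff ((c , e') ∷ p) e = (if ⌊ e' ℚP.≟ e ⌋ then c else ℤ.0ℤ) ℤ.+ coeff p e

infix 4 _≈ₚ_
_≈ₚ_ : Puiseux → Puiseux → Set
p ≈ₚ r = (e : ℚ) → coeff p e ≡ coeff r e

mono : ℤ → ℚ → Puiseux
mono c e = (c , e) ∷ []

infixl 6 _⊕_
_⊕_ : Puiseux → Puiseux → Puiseux
_⊕_ = _++_

infixl 7 _⊛_
_⊛_ : ℤ → Puiseux → Puiseux
c ⊛ p = map (λ { (d , e) → (c ℤ.* d , e) }) p

t^ : ℚ → Puiseux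
t^ e = mono (ℤ.+ 1) e

ℕtoℚ : ℕ → ℚ
ℕtoℚ m = ℤ.+ m ℚ./ 1

module Lattice {q : ℕ} (F : FiniteField q) (n : ℕ) where
  open FiniteField F

  E : Set
  E = Vec (Fin q) n

  allVecs : (m : ℕ) → List (Vec (Fin q) m)
  allVecs zero    = [] ∷ []
  allVecs (suc m) = concatMap (λ x → map (x ∷_) (allVecs m)) (allFin q)

  index : {m : ℕ} → Vec (Fin q) m → Fin (q ℕ.^ m)
  index []      = zero
  index (x ∷ v) = combine x (index v)

  -- subsets of E (characteristic vectors indexed as above)
  SubE : Set
  SubE = Subset (q ℕ.^ n)

  _∈ᵇ_ : E → SubE → Bool
  v ∈ᵇ A = lookup A (index v)

  zeroV : E
  zeroV = Vec.replicate n 0#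

  _+ᵥ_ : E → E → E
  _+ᵥ_ = zipWith _+_

  _·ᵥ_ : Fin q → E → E
  c ·ᵥ v = Vec.map (c *_) v

  isSubspaceᵇ : SubE → Bool
  isSubspaceᵇ A =
    (zeroV ∈ᵇ A)
    ∧ all (λ v → all (λ w → if (v ∈ᵇ A) ∧ (w ∈ᵇ A) then (v +ᵥ w) ∈ᵇ A else true)
                     (allVecs n)) (allVecs n)
    ∧ all (λ c → all (λ v → if v ∈ᵇ A then (c ·ᵥ v) ∈ᵇ A else true)
                     (allVecs n)) (allFin q)

  allSubsets : (N : ℕ) → List (Subset N)
  allSubsets zero    = Vec.[] ∷ []
  allSubsets (suc N) = concatMap (λ b → map (b Vec.∷_) (allSubsets N)) (true ∷ false ∷ [])

  𝓛 : List SubE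
  𝓛 = filter (λ A → isSubspaceᵇ A Bool.≟ true) (allSubsets (q ℕ.^ n))

  -- dimension of a subspace V: the d with |V| = q^d, computed as the
  -- number of j ∈ {1..n} with q^j ≤ |V|
  dim : SubE → ℕ
  dim V = length (filter (λ j → q ℕ.^ suc j ℕ.≤? ∣ V ∣) (upTo n))

  Eₛ : SubE
  Eₛ = ⊤

  memberᵇ : SubE → List SubE → Bool
  memberᵇ V S = any (λ W → ⌊ ≡-dec BoolP._≟_ V W ⌋) S

  ρpaving : ℕ → List SubE → SubE → ℕ
  ρpaving k S V = if memberᵇ V S then k ℕ.∸ 1 else dim V ⊓ k

  ρmix : ℚ → (SubE → ℚ) → (SubE → ℚ) → SubE → ℚ
  ρmix l ρ₁ ρ₂ V = l ℚ.* ρ₁ V ℚ.+ (ℚ.1ℚ ℚ.- l) ℚ.* ρ₂ V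

  ρpavingℚ : ℕ → List SubE → SubE → ℚ
  ρpavingℚ k S V = ℕtoℚ (ρpaving k S V)

  χ : (SubE → ℚ) → Puiseux
  χ ρ = List.foldr _⊕_ []
          (map (λ X → ((ℤ.- ℤ.1ℤ) ℤ.^ dim X ℤ.* ℤ.+ (q ℕ.^ (dim X Data.Nat.Combinatorics.C 2)))
                        ⊛ t^ (ρ Eₛ ℚ.- ρ X))
               𝓛)

{-# OPTIONS --safe #-}
module Submission where

-- Write χ ρ = Σ_X w(X) t^(ρ(E) - ρ(X)) over all subspaces X.  The two paving
-- ranks and their mixture ρ = λρ₁ + (1-λ)ρ₂ all give E rank k, and agree with
-- min(dim X, k) off S₁ ∪ S₂, so there the three exponents coincide.  On S₁
-- the exponents of χ₁, χ₂, χ are 1, 0, λ, on S₂ they are 0, 1, 1-λ, and every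
-- X ∈ S₁ ∪ S₂ has weight w(X) = (-1)^k q^(k choose 2).  So χ differs from χᵢ
-- by |S₁| copies of one binomial and |S₂| copies of another.  Everything is
-- checked coefficientwise, where χ becomes an integer sum over the list 𝓛 and
-- the copies are counted with indicator sums.

open import Defs
open import Data.Nat using (ℕ; _≤_; _<_; _+_; _^_)
open import Data.Nat.Combinatorics using (_C_)
open import Data.Integer as ℤ using (ℤ)
open import Data.Rational as ℚ using (ℚ; 0ℚ; 1ℚ)
open import Data.Fin.Subset using (_∩_)
open import Data.List using (List; length)
open import Data.List.Membership.Propositional using (_∈_)
open import Data.List.Relation.Unary.All using (All)
open import Data.List.Relation.Unary.Unique.Propositional using (Unique)
open import Data.Bool using (true)
open import Data.Product using (_×_)
open import Data.Empty using (⊥)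
open import Relation.Binary.PropositionalEquality using (_≡_; _≢_)

open import Data.Nat as ℕ using (zero; suc; _⊓_; _∸_; z≤n)
import Data.Nat.Properties as ℕP
import Data.Integer.Properties as ℤP
open import Data.Integer.Tactic.RingSolver using (solve-∀)
import Data.Rational.Properties as ℚP
open import Data.Rational.Solver using (module +-*-Solver)
open import Data.Rational.Unnormalised as ℚᵘ using (mkℚᵘ; *≡*)
import Data.Rational.Unnormalised.Properties as ℚᵘP
open import Data.Bool as Bool using (false; if_then_else_)
import Data.Bool.Properties as BoolP
open import Data.Vec as Vec using ([]; _∷_)
open import Data.Vec.Properties using (≡-dec)
open import Data.Fin.Subset using (Subset; ∣_∣)
open import Data.Fin.Subset.Properties using (∣⊤∣≡n)
open import Data.List as List using ([]; _∷_; _++_; map; filter; upTo)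
open import Data.List.Membership.Propositional using (_∉_)
import Data.List.Membership.DecPropositional as DecMembership
open import Data.List.Membership.Propositional.Properties
  using (∈-map⁺; ∈-map⁻; ∈-++⁺ˡ; ∈-++⁺ʳ; ∈-++⁻; ∈-filter⁺)
open import Data.List.Relation.Unary.Any using (here; there)
import Data.List.Relation.Unary.All as All
open import Data.List.Relation.Unary.All using ([]; _∷_)
import Data.List.Relation.Unary.All.Properties as AllP
open import Data.List.Relation.Unary.AllPairs using ([]; _∷_)
import Data.List.Relation.Unary.Unique.Propositional.Properties as UniqueP
import Data.List.Properties as ListP
open import Data.Product using (_,_; proj₁; proj₂)
open import Data.Sum using (inj₁; inj₂)
open import Function using (_∘_)
open import Data.Empty using (⊥-elim)
open import Relation.Binary.Definitions using (DecidableEquality)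
open import Relation.Nullary using (Dec; yes; no; ¬_; does)
open import Relation.Nullary.Decidable using (⌊_⌋; isYes≗does; dec-true; dec-false; _⊎-dec_)
open import Relation.Binary.PropositionalEquality
  using (refl; sym; trans; cong; cong₂; subst; module ≡-Reasoning)

ℕtoℚ-suc : ∀ m → ℕtoℚ (suc m) ≡ ℕtoℚ m ℚ.+ 1ℚ
-- ℕtoℚ m is definitionally fromℚᵘ (mkℚᵘ (+ m) 0).
ℕtoℚ-suc m = ℚP.toℚᵘ-injective (begin-equality
  ℚ.toℚᵘ (ℕtoℚ (suc m))            ≃⟨ ℚP.toℚᵘ-fromℚᵘ (mkℚᵘ (ℤ.+ suc m) 0) ⟩
  mkℚᵘ (ℤ.+ suc m) 0                ≃⟨ *≡* (cross-multiplied (ℤ.+ m)) ⟩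
  mkℚᵘ (ℤ.+ m) 0 ℚᵘ.+ ℚᵘ.1ℚᵘ        ≃⟨ ℚᵘP.+-cong (ℚP.toℚᵘ-fromℚᵘ (mkℚᵘ (ℤ.+ m) 0)) (ℚP.toℚᵘ-fromℚᵘ ℚᵘ.1ℚᵘ) ⟨
  ℚ.toℚᵘ (ℕtoℚ m) ℚᵘ.+ ℚ.toℚᵘ 1ℚ   ≃⟨ ℚP.toℚᵘ-homo-+ (ℕtoℚ m) 1ℚ ⟨
  ℚ.toℚᵘ (ℕtoℚ m ℚ.+ 1ℚ)           ∎)
  where
  open ℚᵘP.≤-Reasoning
  cross-multiplied : ∀ x → (ℤ.+ 1 ℤ.+ x) ℤ.* (ℤ.+ 1 ℤ.* ℤ.+ 1)
                         ≡ (x ℤ.* ℤ.+ 1 ℤ.+ ℤ.+ 1 ℤ.* ℤ.+ 1) ℤ.* ℤ.+ 1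
  cross-multiplied = solve-∀

ℕtoℚ-pred : ∀ {k} → 1 ≤ k → ℕtoℚ k ℚ.- ℕtoℚ (k ∸ 1) ≡ 1ℚ
ℕtoℚ-pred {suc k} _ = trans (cong (ℚ._- ℕtoℚ k) (ℕtoℚ-suc k)) (+1-cancel (ℕtoℚ k))
  where
  open +-*-Solver
  +1-cancel : ∀ x → (x ℚ.+ 1ℚ) ℚ.- x ≡ 1ℚ
  +1-cancel = solve 1 (λ x → (x :+ con 1ℚ) :- x := con 1ℚ) refl

coeff-⊕ : ∀ p r e → coeff (p ⊕ r) e ≡ coeff p e ℤ.+ coeff r e
coeff-⊕ []             r e = sym (ℤP.+-identityˡ (coeff r e))
coeff-⊕ ((c , e') ∷ p) r e =
  trans (cong (ℤ._+_ head) (coeff-⊕ p r e)) (sym (ℤP.+-assoc head (coeff p e) (coeff r e)))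
  where head = if ⌊ e' ℚP.≟ e ⌋ then c else ℤ.0ℤ

coeff-⊛ : ∀ c p e → coeff (c ⊛ p) e ≡ c ℤ.* coeff p e
coeff-⊛ c []             e = sym (ℤP.*-zeroʳ c)
coeff-⊛ c ((d , e') ∷ p) e = begin
  head (c ℤ.* d) ℤ.+ coeff (c ⊛ p) e    ≡⟨ cong₂ ℤ._+_ (head-scale ⌊ e' ℚP.≟ e ⌋) (coeff-⊛ c p e) ⟩
  c ℤ.* head d ℤ.+ c ℤ.* coeff p e      ≡⟨ ℤP.*-distribˡ-+ c (head d) (coeff p e) ⟨
  c ℤ.* (head d ℤ.+ coeff p e)          ∎
  where
  open ≡-Reasoning
  head : ℤ → ℤ
  head x = if ⌊ e' ℚP.≟ e ⌋ then x else ℤ.0ℤ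
  head-scale : ∀ b → (if b then c ℤ.* d else ℤ.0ℤ) ≡ c ℤ.* (if b then d else ℤ.0ℤ)
  head-scale true  = refl
  head-scale false = sym (ℤP.*-zeroʳ c)

coeff-⊛-split : ∀ c p r e →
  coeff (c ⊛ p) e ≡ coeff (c ⊛ r) e ℤ.+ coeff (c ⊛ (p ⊕ (ℤ.- ℤ.1ℤ) ⊛ r)) e
coeff-⊛-split c p r e = begin
  coeff (c ⊛ p) e                                   ≡⟨ coeff-⊛ c p e ⟩
  c ℤ.* P                                           ≡⟨ split c P R ⟩
  c ℤ.* R ℤ.+ c ℤ.* (P ℤ.+ (ℤ.- ℤ.1ℤ) ℤ.* R)         ≡⟨ cong₂ ℤ._+_ (coeff-⊛ c r e) difference ⟨
  coeff (c ⊛ r) e ℤ.+ coeff (c ⊛ (p ⊕ (ℤ.- ℤ.1ℤ) ⊛ r)) e ∎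
  where
  open ≡-Reasoning
  P = coeff p e
  R = coeff r e
  split : ∀ c P R → c ℤ.* P ≡ c ℤ.* R ℤ.+ c ℤ.* (P ℤ.+ (ℤ.- ℤ.1ℤ) ℤ.* R)
  split = solve-∀
  difference : coeff (c ⊛ (p ⊕ (ℤ.- ℤ.1ℤ) ⊛ r)) e ≡ c ℤ.* (P ℤ.+ (ℤ.- ℤ.1ℤ) ℤ.* R)
  difference = trans (coeff-⊛ c (p ⊕ (ℤ.- ℤ.1ℤ) ⊛ r) e)
    (cong (c ℤ.*_) (trans (coeff-⊕ p ((ℤ.- ℤ.1ℤ) ⊛ r) e) (cong (ℤ._+_ P) (coeff-⊛ (ℤ.- ℤ.1ℤ) r e))))

coeff-⊕-⊛-⊕-⊛ : ∀ p c s r s' r' e →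
  coeff (p ⊕ c ⊛ (s ⊛ r ⊕ s' ⊛ r')) e
    ≡ coeff p e ℤ.+ s ℤ.* coeff (c ⊛ r) e ℤ.+ s' ℤ.* coeff (c ⊛ r') e
coeff-⊕-⊛-⊕-⊛ p c s r s' r' e = begin
  coeff (p ⊕ c ⊛ (s ⊛ r ⊕ s' ⊛ r')) e
    ≡⟨ coeff-⊕ p (c ⊛ (s ⊛ r ⊕ s' ⊛ r')) e ⟩
  coeff p e ℤ.+ coeff (c ⊛ (s ⊛ r ⊕ s' ⊛ r')) e
    ≡⟨ cong (ℤ._+_ (coeff p e)) (trans (coeff-⊛ c (s ⊛ r ⊕ s' ⊛ r') e) (cong (c ℤ.*_) (coeff-⊕ (s ⊛ r) (s' ⊛ r') e))) ⟩
  coeff p e ℤ.+ c ℤ.* (coeff (s ⊛ r) e ℤ.+ coeff (s' ⊛ r') e)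
    ≡⟨ cong (λ x → coeff p e ℤ.+ c ℤ.* x) (cong₂ ℤ._+_ (coeff-⊛ s r e) (coeff-⊛ s' r' e)) ⟩
  coeff p e ℤ.+ c ℤ.* (s ℤ.* coeff r e ℤ.+ s' ℤ.* coeff r' e)
    ≡⟨ regroup (coeff p e) c s (coeff r e) s' (coeff r' e) ⟩
  coeff p e ℤ.+ s ℤ.* (c ℤ.* coeff r e) ℤ.+ s' ℤ.* (c ℤ.* coeff r' e)
    ≡⟨ cong₂ (λ x y → coeff p e ℤ.+ s ℤ.* x ℤ.+ s' ℤ.* y) (coeff-⊛ c r e) (coeff-⊛ c r' e) ⟨
  coeff p e ℤ.+ s ℤ.* coeff (c ⊛ r) e ℤ.+ s' ℤ.* coeff (c ⊛ r') e ∎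
  where
  open ≡-Reasoning
  regroup : ∀ P c s R s' R' → P ℤ.+ c ℤ.* (s ℤ.* R ℤ.+ s' ℤ.* R')
                            ≡ P ℤ.+ s ℤ.* (c ℤ.* R) ℤ.+ s' ℤ.* (c ℤ.* R')
  regroup = solve-∀

∑ : {A : Set} → List A → (A → ℤ) → ℤ
∑ []       f = ℤ.0ℤ
∑ (x ∷ xs) f = f x ℤ.+ ∑ xs f

∑-cong : {A : Set} (xs : List A) {f g : A → ℤ} → (∀ x → f x ≡ g x) → ∑ xs f ≡ ∑ xs g
∑-cong []       f≗g = refl
∑-cong (x ∷ xs) f≗g = cong₂ ℤ._+_ (f≗g x) (∑-cong xs f≗g)

∑-zero : {A : Set} (xs : List A) → ∑ xs (λ _ → ℤ.0ℤ) ≡ ℤ.0ℤ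
∑-zero []       = refl
∑-zero (x ∷ xs) = trans (ℤP.+-identityˡ _) (∑-zero xs)

∑-+ : {A : Set} (xs : List A) (f g : A → ℤ) → ∑ xs (λ x → f x ℤ.+ g x) ≡ ∑ xs f ℤ.+ ∑ xs g
∑-+ []       f g = refl
∑-+ (x ∷ xs) f g =
  trans (cong (ℤ._+_ (f x ℤ.+ g x)) (∑-+ xs f g)) (interchange (f x) (g x) (∑ xs f) (∑ xs g))
  where
  interchange : ∀ a b c d → a ℤ.+ b ℤ.+ (c ℤ.+ d) ≡ a ℤ.+ c ℤ.+ (b ℤ.+ d)
  interchange = solve-∀

∑-*ʳ : {A : Set} (xs : List A) (f : A → ℤ) (a : ℤ) → ∑ xs (λ x → f x ℤ.* a) ≡ ∑ xs f ℤ.* a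
∑-*ʳ []       f a = refl
∑-*ʳ (x ∷ xs) f a =
  trans (cong (ℤ._+_ (f x ℤ.* a)) (∑-*ʳ xs f a)) (sym (ℤP.*-distribʳ-+ a (f x) (∑ xs f)))

∑ₚ : {A : Set} → List A → (A → Puiseux) → Puiseux
∑ₚ xs h = List.foldr _⊕_ [] (map h xs)

coeff-∑ₚ : {A : Set} (xs : List A) (h : A → Puiseux) (e : ℚ) →
  coeff (∑ₚ xs h) e ≡ ∑ xs (λ x → coeff (h x) e)
coeff-∑ₚ []       h e = refl
coeff-∑ₚ (x ∷ xs) h e = trans (coeff-⊕ (h x) (∑ₚ xs h) e) (cong (ℤ._+_ (coeff (h x) e)) (coeff-∑ₚ xs h e))

𝟙 : {P : Set} → Dec P → ℤ
𝟙 P? = if does P? then ℤ.1ℤ else ℤ.0ℤ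

𝟙-no : {P : Set} (P? : Dec P) → ¬ P → 𝟙 P? ≡ ℤ.0ℤ
𝟙-no P? ¬p = cong (λ b → if b then ℤ.1ℤ else ℤ.0ℤ) (dec-false P? ¬p)

𝟙-⊎ : {P Q : Set} (P? : Dec P) (Q? : Dec Q) → (P → ¬ Q) → 𝟙 (P? ⊎-dec Q?) ≡ 𝟙 P? ℤ.+ 𝟙 Q?
𝟙-⊎ (yes p) Q? p⇒¬q = sym (cong (ℤ._+_ ℤ.1ℤ) (𝟙-no Q? (p⇒¬q p)))
𝟙-⊎ (no _)  Q? _    = sym (ℤP.+-identityˡ (𝟙 Q?))

module IndicatorSums {A : Set} (_≟_ : DecidableEquality A) where
  open DecMembership _≟_ using (_∈?_)

  ∑-𝟙-≟-∉ : ∀ {y} xs → y ∉ xs → ∑ xs (λ x → 𝟙 (x ≟ y)) ≡ ℤ.0ℤ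
  ∑-𝟙-≟-∉     []       _  = refl
  ∑-𝟙-≟-∉ {y} (x ∷ xs) y∉ with x ≟ y
  ... | yes x≡y = ⊥-elim (y∉ (here (sym x≡y)))
  ... | no  _   = trans (ℤP.+-identityˡ _) (∑-𝟙-≟-∉ xs (y∉ ∘ there))

  ∑-𝟙-≟-∈ : ∀ {y} xs → Unique xs → y ∈ xs → ∑ xs (λ x → 𝟙 (x ≟ y)) ≡ ℤ.1ℤ
  ∑-𝟙-≟-∈ {y} (x ∷ xs) (x∉xs ∷ xs!) y∈ with x ≟ y | y∈
  ... | yes refl | _         = cong (ℤ._+_ ℤ.1ℤ) (∑-𝟙-≟-∉ xs (AllP.All¬⇒¬Any x∉xs))
  ... | no  x≢y  | here y≡x  = ⊥-elim (x≢y (sym y≡x))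
  ... | no  _    | there y∈′ = trans (ℤP.+-identityˡ _) (∑-𝟙-≟-∈ xs xs! y∈′)

  ∑-𝟙-∈? : ∀ xs ys → Unique xs → Unique ys → All (_∈ xs) ys →
    ∑ xs (λ x → 𝟙 (x ∈? ys)) ≡ ℤ.+ length ys
  ∑-𝟙-∈? xs []       _   _             _             = ∑-zero xs
  ∑-𝟙-∈? xs (y ∷ ys) xs! (y∉ys ∷ ys!) (y∈xs ∷ ys⊆xs) = begin
    ∑ xs (λ x → 𝟙 (x ∈? y ∷ ys))                        ≡⟨ ∑-cong xs split ⟩
    ∑ xs (λ x → 𝟙 (x ≟ y) ℤ.+ 𝟙 (x ∈? ys))              ≡⟨ ∑-+ xs _ _ ⟩
    ∑ xs (λ x → 𝟙 (x ≟ y)) ℤ.+ ∑ xs (λ x → 𝟙 (x ∈? ys)) ≡⟨ cong₂ ℤ._+_ (∑-𝟙-≟-∈ xs xs! y∈xs)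
                                                                        (∑-𝟙-∈? xs ys xs! ys! ys⊆xs) ⟩
    ℤ.+ suc (length ys)                                  ∎
    where
    open ≡-Reasoning
    -- x ∈? y ∷ ys is a Dec.map′ of (x ≟ y) ⊎-dec (x ∈? ys), with the same `does`.
    split : ∀ x → 𝟙 (x ∈? y ∷ ys) ≡ 𝟙 (x ≟ y) ℤ.+ 𝟙 (x ∈? ys)
    split x = 𝟙-⊎ (x ≟ y) (x ∈? ys) λ { refl → AllP.All¬⇒¬Any y∉ys }

  ∑-perturb : ∀ {xs S₁ S₂ : List A} {f g : A → ℤ} {α β : ℤ} →
    Unique xs → Unique S₁ → Unique S₂ → All (_∈ xs) S₁ → All (_∈ xs) S₂ →
    (∀ {x} → x ∈ S₁ → x ∈ S₂ → ⊥) →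
    (∀ {x} → x ∈ S₁ → f x ≡ g x ℤ.+ α) →
    (∀ {x} → x ∈ S₂ → f x ≡ g x ℤ.+ β) →
    (∀ {x} → x ∉ S₁ → x ∉ S₂ → f x ≡ g x) →
    ∑ xs f ≡ ∑ xs g ℤ.+ ℤ.+ length S₁ ℤ.* α ℤ.+ ℤ.+ length S₂ ℤ.* β
  ∑-perturb {xs} {S₁} {S₂} {f} {g} {α} {β} xs! S₁! S₂! S₁⊆xs S₂⊆xs disjoint on-S₁ on-S₂ elsewhere =
    begin
      ∑ xs f
        ≡⟨ ∑-cong xs pointwise ⟩
      ∑ xs (λ x → g x ℤ.+ 𝟙₁ x ℤ.* α ℤ.+ 𝟙₂ x ℤ.* β)
        ≡⟨ ∑-+ xs _ _ ⟩
      ∑ xs (λ x → g x ℤ.+ 𝟙₁ x ℤ.* α) ℤ.+ ∑ xs (λ x → 𝟙₂ x ℤ.* β)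
        ≡⟨ cong₂ ℤ._+_ (∑-+ xs _ _) (∑-*ʳ xs 𝟙₂ β) ⟩
      ∑ xs g ℤ.+ ∑ xs (λ x → 𝟙₁ x ℤ.* α) ℤ.+ ∑ xs 𝟙₂ ℤ.* β
        ≡⟨ cong (λ a → ∑ xs g ℤ.+ a ℤ.+ ∑ xs 𝟙₂ ℤ.* β) (∑-*ʳ xs 𝟙₁ α) ⟩
      ∑ xs g ℤ.+ ∑ xs 𝟙₁ ℤ.* α ℤ.+ ∑ xs 𝟙₂ ℤ.* β
        ≡⟨ cong₂ (λ a b → ∑ xs g ℤ.+ a ℤ.* α ℤ.+ b ℤ.* β)
                 (∑-𝟙-∈? xs S₁ xs! S₁! S₁⊆xs) (∑-𝟙-∈? xs S₂ xs! S₂! S₂⊆xs) ⟩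
      ∑ xs g ℤ.+ ℤ.+ length S₁ ℤ.* α ℤ.+ ℤ.+ length S₂ ℤ.* β
    ∎
    where
    open ≡-Reasoning
    𝟙₁ 𝟙₂ : A → ℤ
    𝟙₁ x = 𝟙 (x ∈? S₁)
    𝟙₂ x = 𝟙 (x ∈? S₂)
    only-α : ∀ a α β → a ℤ.+ α ≡ a ℤ.+ ℤ.1ℤ ℤ.* α ℤ.+ ℤ.0ℤ ℤ.* β
    only-α = solve-∀
    only-β : ∀ a α β → a ℤ.+ β ≡ a ℤ.+ ℤ.0ℤ ℤ.* α ℤ.+ ℤ.1ℤ ℤ.* β
    only-β = solve-∀
    neither : ∀ a α β → a ≡ a ℤ.+ ℤ.0ℤ ℤ.* α ℤ.+ ℤ.0ℤ ℤ.* β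
    neither = solve-∀
    pointwise : ∀ x → f x ≡ g x ℤ.+ 𝟙₁ x ℤ.* α ℤ.+ 𝟙₂ x ℤ.* β
    pointwise x with x ∈? S₁ | x ∈? S₂
    ... | yes x∈S₁ | yes x∈S₂ = ⊥-elim (disjoint x∈S₁ x∈S₂)
    ... | yes x∈S₁ | no  _    = trans (on-S₁ x∈S₁) (only-α (g x) α β)
    ... | no  _    | yes x∈S₂ = trans (on-S₂ x∈S₂) (only-β (g x) α β)
    ... | no  x∉S₁ | no  x∉S₂ = trans (elsewhere x∉S₁ x∉S₂) (neither (g x) α β)

^-suc≤^ : ∀ q {i n} → i < n → q ^ suc i ≤ q ^ n
^-suc≤^ zero    _   = z≤n
^-suc≤^ (suc q) i<n = ℕP.^-monoʳ-≤ (suc q) i<n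

module LatticeFacts {q : ℕ} (F : FiniteField q) (n : ℕ) where
  open Lattice F n

  _≟ₛ_ : DecidableEquality SubE
  _≟ₛ_ = ≡-dec BoolP._≟_

  open DecMembership _≟ₛ_ using (_∈?_)

  allSubsets-unique : ∀ N → Unique (allSubsets N)
  allSubsets-unique zero    = [] ∷ []
  allSubsets-unique (suc N) =
    UniqueP.++⁺ (UniqueP.map⁺ (cong Vec.tail) (allSubsets-unique N))
                (UniqueP.++⁺ (UniqueP.map⁺ (cong Vec.tail) (allSubsets-unique N)) [] λ ())
                heads-differ
    where
    heads-differ : ∀ {V} → ¬ (V ∈ map (true ∷_) (allSubsets N)
                              × V ∈ map (false ∷_) (allSubsets N) ++ [])
    heads-differ (V∈true , V∈false)
      with ∈-map⁻ (true ∷_) V∈true | ∈-++⁻ (map (false ∷_) (allSubsets N)) V∈false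
    ... | _               | inj₂ ()
    ... | (_ , _ , refl) | inj₁ V∈false′ with ∈-map⁻ (false ∷_) V∈false′
    ...   | (_ , _ , ())

  ∈-allSubsets : ∀ N (V : Subset N) → V ∈ allSubsets N
  ∈-allSubsets zero    []          = here refl
  ∈-allSubsets (suc N) (true ∷ V)  = ∈-++⁺ˡ (∈-map⁺ (true ∷_) (∈-allSubsets N V))
  ∈-allSubsets (suc N) (false ∷ V) =
    ∈-++⁺ʳ (map (true ∷_) (allSubsets N)) (∈-++⁺ˡ (∈-map⁺ (false ∷_) (∈-allSubsets N V)))

  𝓛-unique : Unique 𝓛
  𝓛-unique = UniqueP.filter⁺ (λ A → isSubspaceᵇ A Bool.≟ true) (allSubsets-unique (q ^ n))

  ∈-𝓛 : ∀ {V} → isSubspaceᵇ V ≡ true → V ∈ 𝓛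
  ∈-𝓛 {V} = ∈-filter⁺ (λ A → isSubspaceᵇ A Bool.≟ true) (∈-allSubsets (q ^ n) V)

  dim-Eₛ : dim Eₛ ≡ n
  dim-Eₛ = trans (cong length (ListP.filter-all (λ j → q ^ suc j ℕ.≤? ∣ Eₛ ∣) all-below))
                 (ListP.length-upTo n)
    where
    all-below : All (λ j → q ^ suc j ≤ ∣ Eₛ ∣) (upTo n)
    all-below = AllP.applyUpTo⁺₁ (λ j → j) n
      (λ {i} i<n → subst (q ^ suc i ≤_) (sym (∣⊤∣≡n (q ^ n))) (^-suc≤^ q i<n))

  memberᵇ≡does : ∀ V S → memberᵇ V S ≡ does (V ∈? S)
  memberᵇ≡does V []      = refl
  memberᵇ≡does V (W ∷ S) = cong₂ Bool._∨_ (isYes≗does (V ≟ₛ W)) (memberᵇ≡does V S)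

  SubspacesOfDim : ℕ → List SubE → Set
  SubspacesOfDim k = All (λ V → (isSubspaceᵇ V ≡ true) × (dim V ≡ k))

  ρpaving-∈ : ∀ {k S X} → X ∈ S → ρpaving k S X ≡ k ∸ 1
  ρpaving-∈ {k} {S} {X} X∈S = cong (λ b → if b then k ∸ 1 else dim X ⊓ k)
    (trans (memberᵇ≡does X S) (dec-true (X ∈? S) X∈S))

  ρpaving-∉ : ∀ {k S X} → X ∉ S → ρpaving k S X ≡ dim X ⊓ k
  ρpaving-∉ {k} {S} {X} X∉S = cong (λ b → if b then k ∸ 1 else dim X ⊓ k)
    (trans (memberᵇ≡does X S) (dec-false (X ∈? S) X∉S))

  gap : (SubE → ℚ) → SubE → ℚ
  gap ρ X = ρ Eₛ ℚ.- ρ X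

  weight : SubE → ℤ
  weight X = (ℤ.- ℤ.1ℤ) ℤ.^ dim X ℤ.* ℤ.+ (q ^ (dim X C 2))

  term : (SubE → ℚ) → SubE → Puiseux
  term ρ X = weight X ⊛ t^ (gap ρ X)

  -- χ ρ unfolds to ∑ₚ 𝓛 (term ρ).
  coeff-χ : ∀ ρ e → coeff (χ ρ) e ≡ ∑ 𝓛 (λ X → coeff (term ρ X) e)
  coeff-χ ρ = coeff-∑ₚ 𝓛 (term ρ)

  module _ (l : ℚ) (ρ₁ ρ₂ : SubE → ℚ) (X : SubE) where
    open +-*-Solver

    gap-ρmix : gap (ρmix l ρ₁ ρ₂) X ≡ l ℚ.* gap ρ₁ X ℚ.+ (1ℚ ℚ.- l) ℚ.* gap ρ₂ X
    gap-ρmix = solve 5 (λ l a b c d →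
        (l :* a :+ (con 1ℚ :- l) :* b) :- (l :* c :+ (con 1ℚ :- l) :* d)
      := l :* (a :- c) :+ (con 1ℚ :- l) :* (b :- d)) refl l (ρ₁ Eₛ) (ρ₂ Eₛ) (ρ₁ X) (ρ₂ X)

    gap-ρmix-same : ∀ {d} → gap ρ₁ X ≡ d → gap ρ₂ X ≡ d → gap (ρmix l ρ₁ ρ₂) X ≡ d
    gap-ρmix-same {d} refl g₂≡d = trans gap-ρmix (trans (cong (λ g → l ℚ.* d ℚ.+ (1ℚ ℚ.- l) ℚ.* g) g₂≡d)
      (solve 2 (λ l d → l :* d :+ (con 1ℚ :- l) :* d := d) refl l d))

    gap-ρmix-1-0 : gap ρ₁ X ≡ 1ℚ → gap ρ₂ X ≡ 0ℚ → gap (ρmix l ρ₁ ρ₂) X ≡ l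
    gap-ρmix-1-0 g₁≡1 g₂≡0 = trans gap-ρmix (trans (cong₂ (λ g₁ g₂ → l ℚ.* g₁ ℚ.+ (1ℚ ℚ.- l) ℚ.* g₂) g₁≡1 g₂≡0)
      (solve 1 (λ l → l :* con 1ℚ :+ (con 1ℚ :- l) :* con 0ℚ := l) refl l))

    gap-ρmix-0-1 : gap ρ₁ X ≡ 0ℚ → gap ρ₂ X ≡ 1ℚ → gap (ρmix l ρ₁ ρ₂) X ≡ 1ℚ ℚ.- l
    gap-ρmix-0-1 g₁≡0 g₂≡1 = trans gap-ρmix (trans (cong₂ (λ g₁ g₂ → l ℚ.* g₁ ℚ.+ (1ℚ ℚ.- l) ℚ.* g₂) g₁≡0 g₂≡1)
      (solve 1 (λ l → l :* con 0ℚ :+ (con 1ℚ :- l) :* con 1ℚ := con 1ℚ :- l) refl l))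

module PavingGaps {q : ℕ} (F : FiniteField q) {n k : ℕ} (1≤k : 1 ≤ k) (k<n : k < n)
                  (S : List (Lattice.SubE F n)) (S-dim : ∀ {V} → V ∈ S → Lattice.dim F n V ≡ k) where
  open Lattice F n
  open LatticeFacts F n

  ρpaving-Eₛ : ρpavingℚ k S Eₛ ≡ ℕtoℚ k
  ρpaving-Eₛ = cong ℕtoℚ (trans (ρpaving-∉ Eₛ∉S) (trans (cong (_⊓ k) dim-Eₛ) (ℕP.m≥n⇒m⊓n≡n (ℕP.<⇒≤ k<n))))
    where
    Eₛ∉S : Eₛ ∉ S
    Eₛ∉S Eₛ∈S = ℕP.<-irrefl (trans (sym (S-dim Eₛ∈S)) dim-Eₛ) k<n

  gap-paving-∈ : ∀ {X} → X ∈ S → gap (ρpavingℚ k S) X ≡ 1ℚ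
  gap-paving-∈ X∈S = trans (cong₂ ℚ._-_ ρpaving-Eₛ (cong ℕtoℚ (ρpaving-∈ X∈S))) (ℕtoℚ-pred 1≤k)

  gap-paving-∉ : ∀ {X} → X ∉ S → gap (ρpavingℚ k S) X ≡ ℕtoℚ k ℚ.- ℕtoℚ (dim X ⊓ k)
  gap-paving-∉ X∉S = cong₂ ℚ._-_ ρpaving-Eₛ (cong ℕtoℚ (ρpaving-∉ X∉S))

  gap-paving-∉-dim : ∀ {X} → X ∉ S → dim X ≡ k → gap (ρpavingℚ k S) X ≡ 0ℚ
  gap-paving-∉-dim {X} X∉S dimX≡k = begin
    gap (ρpavingℚ k S) X ≡⟨ gap-paving-∉ X∉S ⟩
    ℕtoℚ k ℚ.- ℕtoℚ (dim X ⊓ k) ≡⟨ cong (λ d → ℕtoℚ k ℚ.- ℕtoℚ (d ⊓ k)) dimX≡k ⟩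
    ℕtoℚ k ℚ.- ℕtoℚ (k ⊓ k) ≡⟨ cong (λ d → ℕtoℚ k ℚ.- ℕtoℚ d) (ℕP.⊓-idem k) ⟩
    ℕtoℚ k ℚ.- ℕtoℚ k ≡⟨ ℚP.+-inverseʳ (ℕtoℚ k) ⟩
    0ℚ ∎
    where open ≡-Reasoning

module PavingMixture {q : ℕ} (F : FiniteField q) {n k : ℕ} (1≤k : 1 ≤ k) (k<n : k < n)
  (S₁ S₂ : List (Lattice.SubE F n))
  (S₁-sub : LatticeFacts.SubspacesOfDim F n k S₁) (S₂-sub : LatticeFacts.SubspacesOfDim F n k S₂)
  (S₁! : Unique S₁) (S₂! : Unique S₂) (disjoint : ∀ V → V ∈ S₁ → V ∈ S₂ → ⊥) (l : ℚ) where
  open Lattice F n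
  open LatticeFacts F n
  open IndicatorSums _≟ₛ_ using (∑-perturb)

  ρ₁ ρ₂ ρ : SubE → ℚ
  ρ₁ = ρpavingℚ k S₁
  ρ₂ = ρpavingℚ k S₂
  ρ  = ρmix l ρ₁ ρ₂

  c s₁ s₂ : ℤ
  c  = (ℤ.- ℤ.1ℤ) ℤ.^ k ℤ.* ℤ.+ (q ^ (k C 2))
  s₁ = ℤ.+ length S₁
  s₂ = ℤ.+ length S₂

  dim-S₁ : ∀ {X} → X ∈ S₁ → dim X ≡ k
  dim-S₁ X∈S₁ = proj₂ (All.lookup S₁-sub X∈S₁)

  dim-S₂ : ∀ {X} → X ∈ S₂ → dim X ≡ k
  dim-S₂ X∈S₂ = proj₂ (All.lookup S₂-sub X∈S₂)

  private
    module P₁ = PavingGaps F 1≤k k<n S₁ dim-S₁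
    module P₂ = PavingGaps F 1≤k k<n S₂ dim-S₂

  weight-of-dim-k : ∀ {X} → dim X ≡ k → weight X ≡ c
  weight-of-dim-k = cong (λ d → (ℤ.- ℤ.1ℤ) ℤ.^ d ℤ.* ℤ.+ (q ^ (d C 2)))

  gap₁-S₁ : ∀ {X} → X ∈ S₁ → gap ρ₁ X ≡ 1ℚ
  gap₁-S₁ = P₁.gap-paving-∈

  gap₁-S₂ : ∀ {X} → X ∈ S₂ → gap ρ₁ X ≡ 0ℚ
  gap₁-S₂ X∈S₂ = P₁.gap-paving-∉-dim (λ X∈S₁ → disjoint _ X∈S₁ X∈S₂) (dim-S₂ X∈S₂)

  gap₂-S₁ : ∀ {X} → X ∈ S₁ → gap ρ₂ X ≡ 0ℚ
  gap₂-S₁ X∈S₁ = P₂.gap-paving-∉-dim (disjoint _ X∈S₁) (dim-S₁ X∈S₁)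

  gap₂-S₂ : ∀ {X} → X ∈ S₂ → gap ρ₂ X ≡ 1ℚ
  gap₂-S₂ = P₂.gap-paving-∈

  gap₁≡gap₂ : ∀ {X} → X ∉ S₁ → X ∉ S₂ → gap ρ₁ X ≡ gap ρ₂ X
  gap₁≡gap₂ X∉S₁ X∉S₂ = trans (P₁.gap-paving-∉ X∉S₁) (sym (P₂.gap-paving-∉ X∉S₂))

  coeff-term-shift : ∀ ρ′ {X u a} e → weight X ≡ c → gap ρ X ≡ u → gap ρ′ X ≡ a →
    coeff (term ρ X) e ≡ coeff (term ρ′ X) e ℤ.+ coeff (c ⊛ (t^ u ⊕ (ℤ.- ℤ.1ℤ) ⊛ t^ a)) e
  coeff-term-shift ρ′ {X} {u} {a} e w≡c gap≡u gap′≡a = begin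
    coeff (term ρ X) e  ≡⟨ cong (λ p → coeff p e) (monomial w≡c gap≡u) ⟩
    coeff (c ⊛ t^ u) e  ≡⟨ coeff-⊛-split c (t^ u) (t^ a) e ⟩
    coeff (c ⊛ t^ a) e ℤ.+ coeff (c ⊛ (t^ u ⊕ (ℤ.- ℤ.1ℤ) ⊛ t^ a)) e
      ≡⟨ cong (λ p → coeff p e ℤ.+ coeff (c ⊛ (t^ u ⊕ (ℤ.- ℤ.1ℤ) ⊛ t^ a)) e) (monomial w≡c gap′≡a) ⟨
    coeff (term ρ′ X) e ℤ.+ coeff (c ⊛ (t^ u ⊕ (ℤ.- ℤ.1ℤ) ⊛ t^ a)) e ∎
    where
    open ≡-Reasoning
    monomial : ∀ {w w′ g g′} → w ≡ w′ → g ≡ g′ → w ⊛ t^ g ≡ w′ ⊛ t^ g′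
    monomial = cong₂ (λ w g → w ⊛ t^ g)

  χ-exchange : ∀ ρ′ a b →
    (∀ {X} → X ∈ S₁ → gap ρ′ X ≡ a) → (∀ {X} → X ∈ S₂ → gap ρ′ X ≡ b) →
    (∀ {X} → X ∉ S₁ → X ∉ S₂ → gap ρ X ≡ gap ρ′ X) →
    χ ρ ≈ₚ χ ρ′ ⊕ c ⊛ (s₁ ⊛ (t^ l ⊕ (ℤ.- ℤ.1ℤ) ⊛ t^ a) ⊕ s₂ ⊛ (t^ (1ℚ ℚ.- l) ⊕ (ℤ.- ℤ.1ℤ) ⊛ t^ b))
  χ-exchange ρ′ a b on-S₁ on-S₂ elsewhere e = begin
    coeff (χ ρ) e
      ≡⟨ coeff-χ ρ e ⟩
    ∑ 𝓛 (λ X → coeff (term ρ X) e)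
      ≡⟨ ∑-perturb 𝓛-unique S₁! S₂! (in-𝓛 S₁-sub) (in-𝓛 S₂-sub) (disjoint _)
                   shift-S₁ shift-S₂ (λ {X} X∉S₁ X∉S₂ → cong (λ g → coeff (weight X ⊛ t^ g) e) (elsewhere X∉S₁ X∉S₂)) ⟩
    ∑ 𝓛 (λ X → coeff (term ρ′ X) e) ℤ.+ s₁ ℤ.* coeff (c ⊛ A) e ℤ.+ s₂ ℤ.* coeff (c ⊛ B) e
      ≡⟨ cong (λ x → x ℤ.+ s₁ ℤ.* coeff (c ⊛ A) e ℤ.+ s₂ ℤ.* coeff (c ⊛ B) e) (coeff-χ ρ′ e) ⟨
    coeff (χ ρ′) e ℤ.+ s₁ ℤ.* coeff (c ⊛ A) e ℤ.+ s₂ ℤ.* coeff (c ⊛ B) e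
      ≡⟨ coeff-⊕-⊛-⊕-⊛ (χ ρ′) c s₁ A s₂ B e ⟨
    coeff (χ ρ′ ⊕ c ⊛ (s₁ ⊛ A ⊕ s₂ ⊛ B)) e
    ∎
    where
    open ≡-Reasoning
    A = t^ l ⊕ (ℤ.- ℤ.1ℤ) ⊛ t^ a
    B = t^ (1ℚ ℚ.- l) ⊕ (ℤ.- ℤ.1ℤ) ⊛ t^ b
    in-𝓛 : ∀ {S} → SubspacesOfDim k S → All (_∈ 𝓛) S
    in-𝓛 = All.map (∈-𝓛 ∘ proj₁)
    shift-S₁ : ∀ {X} → X ∈ S₁ → coeff (term ρ X) e ≡ coeff (term ρ′ X) e ℤ.+ coeff (c ⊛ A) e
    shift-S₁ {X} X∈S₁ = coeff-term-shift ρ′ {X} e (weight-of-dim-k {X} (dim-S₁ X∈S₁))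
      (gap-ρmix-1-0 l ρ₁ ρ₂ X (gap₁-S₁ X∈S₁) (gap₂-S₁ X∈S₁)) (on-S₁ X∈S₁)
    shift-S₂ : ∀ {X} → X ∈ S₂ → coeff (term ρ X) e ≡ coeff (term ρ′ X) e ℤ.+ coeff (c ⊛ B) e
    shift-S₂ {X} X∈S₂ = coeff-term-shift ρ′ {X} e (weight-of-dim-k {X} (dim-S₂ X∈S₂))
      (gap-ρmix-0-1 l ρ₁ ρ₂ X (gap₁-S₂ X∈S₂) (gap₂-S₂ X∈S₂)) (on-S₂ X∈S₂)

  χ-mix-from-χ₁ : χ ρ ≈ₚ χ ρ₁ ⊕ c ⊛ (s₁ ⊛ (t^ l ⊕ (ℤ.- ℤ.1ℤ) ⊛ t^ 1ℚ)
                             ⊕ s₂ ⊛ (t^ (1ℚ ℚ.- l) ⊕ (ℤ.- ℤ.1ℤ) ⊛ t^ 0ℚ))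
  χ-mix-from-χ₁ = χ-exchange ρ₁ 1ℚ 0ℚ gap₁-S₁ gap₁-S₂
    (λ X∉S₁ X∉S₂ → gap-ρmix-same l ρ₁ ρ₂ _ refl (sym (gap₁≡gap₂ X∉S₁ X∉S₂)))

  χ-mix-from-χ₂ : χ ρ ≈ₚ χ ρ₂ ⊕ c ⊛ (s₁ ⊛ (t^ l ⊕ (ℤ.- ℤ.1ℤ) ⊛ t^ 0ℚ)
                             ⊕ s₂ ⊛ (t^ (1ℚ ℚ.- l) ⊕ (ℤ.- ℤ.1ℤ) ⊛ t^ 1ℚ))
  χ-mix-from-χ₂ = χ-exchange ρ₂ 0ℚ 1ℚ gap₂-S₁ gap₂-S₂
    (λ X∉S₁ X∉S₂ → gap-ρmix-same l ρ₁ ρ₂ _ (gap₁≡gap₂ X∉S₁ X∉S₂) refl)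

theorem7p4 :
  (q : ℕ) → IsPrimePower q → (F : FiniteField q) →
  (n : ℕ) → 2 ≤ n → (k : ℕ) → 1 ≤ k → k < n →
  let open Lattice F n in
  (S₁ S₂ : List SubE) →
  All (λ V → (isSubspaceᵇ V ≡ true) × (dim V ≡ k)) S₁ →
  All (λ V → (isSubspaceᵇ V ≡ true) × (dim V ≡ k)) S₂ →
  Unique S₁ → Unique S₂ →
  (∀ V → V ∈ S₁ → V ∈ S₂ → ⊥) →
  (∀ V W → V ∈ S₁ → W ∈ S₁ → V ≢ W → dim (V ∩ W) + 2 ≤ k) →
  (∀ V W → V ∈ S₂ → W ∈ S₂ → V ≢ W → dim (V ∩ W) + 2 ≤ k) →
  (l : ℚ) → 0ℚ ℚ.< l → l ℚ.< 1ℚ →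
  let ρ₁ = ρpavingℚ k S₁
      ρ₂ = ρpavingℚ k S₂
      c  = (ℤ.- ℤ.1ℤ) ℤ.^ k ℤ.* ℤ.+ (q ^ (k C 2))
      s₁ = ℤ.+ (length S₁)
      s₂ = ℤ.+ (length S₂)
  in (χ (ρmix l ρ₁ ρ₂) ≈ₚ
        χ ρ₁ ⊕ c ⊛ (s₁ ⊛ (t^ l ⊕ (ℤ.- ℤ.1ℤ) ⊛ t^ 1ℚ)
                   ⊕ s₂ ⊛ (t^ (1ℚ ℚ.- l) ⊕ (ℤ.- ℤ.1ℤ) ⊛ t^ 0ℚ)))
   × (χ (ρmix l ρ₁ ρ₂) ≈ₚ
        χ ρ₂ ⊕ c ⊛ (s₁ ⊛ (t^ l ⊕ (ℤ.- ℤ.1ℤ) ⊛ t^ 0ℚ)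
                   ⊕ s₂ ⊛ (t^ (1ℚ ℚ.- l) ⊕ (ℤ.- ℤ.1ℤ) ⊛ t^ 1ℚ)))
-- The identities hold for every rational l.
theorem7p4 q _ F n _ k 1≤k k<n S₁ S₂ S₁-sub S₂-sub S₁! S₂! disjoint _ _ l _ _ = χ-mix-from-χ₁ , χ-mix-from-χ₂
  where open PavingMixture F 1≤k k<n S₁ S₂ S₁-sub S₂-sub S₁! S₂! disjoint l
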